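{- Let $q$ be a prime power, $n>1$, and let $f,g$ be $q$-polynomials over $\mathbb{F}_{q^n}$. Then the $\mathbb{F}_q$-linear sets $L_f$ and $L_g$ of $\mathrm{PG}(1,q^n)$ are $\mathrm{P\Gamma L}(2,q^n)$-equivalent if and only if there exists $\varphi\in\Gamma\mathrm{L}(2,q^n)$ such that $f_\varphi$ is defined and $Im\,(f_\varphi(x)/x)=Im\,(g(x)/x)$.
   Context: A $q$-polynomial over $\mathbb{F}_{q^n}$ is a polynomial $\sum_{i=0}^{n-1}a_ix^{q^i}$ with coefficients in $\mathbb{F}_{q^n}$; $Im\,(f(x)/x)=\{f(x)/x : x\in\mathbb{F}_{q^n}^*\}$. For such $f$, $L_f=\{\langle (x,f(x))\rangle_{\mathbb{F}_{q^n}} : x\in\mathbb{F}_{q^n}^*\}\subseteq\mathrm{PG}(1,q^n)$ (an $\mathbb{F}_q$-linear set of rank $n$). Two point sets of $\mathrm{PG}(1,q^n)$ are $\mathrm{P\Gamma L}(2,q^n)$-equivalent if some element of $\mathrm{P\Gamma L}(2,q^n)$ maps one onto the other. An element $\varphi\in\Gamma\mathrm{L}(2,q^n)$ acts on $\mathbb{F}_{q^n}^2$ by $(x,y)\mapsto(ax^\sigma+by^\sigma,\ cx^\sigma+dy^\sigma)$ with $\begin{pmatrix}a&b\\c&d\end{pmatrix}$ invertible and $\sigma$ a field automorphism of $\mathbb{F}_{q^n}$. If $k_f(x)=ax^\sigma+bf(x)^\sigma$ is a bijection of $\mathbb{F}_{q^n}$, $f_\varphi$ denotes the $q$-polynomial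 $h_f\circ k_f^{ -1}$ with $h_f(x)=cx^\sigma+df(x)^\sigma$ (so the graph of $f_\varphi$ is the image under $\varphi$ of the graph of $f$). -}

module Defs where

open import Level using (0ℓ)
open import Data.Nat using (ℕ; zero; suc; _<_) renaming (_^_ to _^ℕ_)
open import Data.Nat.Primality using (Prime)
open import Data.Fin using (Fin; zero; suc)
open import Data.Product using (Σ; ∃; ∃-syntax; _×_; _,_)
open import Function.Bundles using (_↔_)
open import Relation.Binary.PropositionalEquality using (_≡_)
open import Relation.Nullary using (¬_)
open import Algebra.Structures using (IsCommutativeRing)

IsPrimePower : ℕ → Set
IsPrimePower q = ∃[ p ] ∃[ k ] (Prime p × 0 < k × q ≡ p ^ℕ k)

record FiniteField (q n : ℕ) : Set₁ where
  infixl 6 _+_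
  infixl 7 _*_
  field
    Carrier : Set
    _+_ _*_ : Carrier → Carrier → Carrier
    -_      : Carrier → Carrier
    0# 1#   : Carrier
    isCommutativeRing : IsCommutativeRing _≡_ _+_ _*_ -_ 0# 1#
    0≢1     : ¬ (0# ≡ 1#)
    _⁻¹     : Carrier → Carrier
    ⁻¹-inverse : ∀ x → ¬ (x ≡ 0#) → x * (x ⁻¹) ≡ 1#
    card    : Carrier ↔ Fin (q ^ℕ n)

module _ {q n : ℕ} (K : FiniteField q n) where
  open FiniteField K

  F : Set
  F = Carrier

  pow : F → ℕ → F
  pow x zero    = 1#
  pow x (suc k) = x * pow x k

  ΣF : (m : ℕ) → (Fin m → F) → F
  ΣF zero    t = 0#
  ΣF (suc m) t = t zero + ΣF m (λ i → t (suc i))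

  -- a q-polynomial  Σ_{i=0}^{n-1} a_i x^{q^i}, given by its coefficients
  QPoly : Set
  QPoly = Fin n → F

  eval : QPoly → F → F
  eval a x = ΣF n (λ i → a i * pow x (q ^ℕ Data.Fin.toℕ i))

  record Bijection (k : F → F) : Set where
    field
      inv    : F → F
      inv-l  : ∀ x → inv (k x) ≡ x
      inv-r  : ∀ y → k (inv y) ≡ y

  record FieldAut : Set where
    field
      σ      : F → F
      σ-bij  : Bijection σ
      σ-+    : ∀ x y → σ (x + y) ≡ σ x + σ y
      σ-*    : ∀ x y → σ (x * y) ≡ σ x * σ y
      σ-1    : σ 1# ≡ 1#

  record ΓL2 : Set where
    field
      a b c d : F
      det≢0   : ¬ (a * d + - (b * c) ≡ 0#)
      aut     : FieldAut

  Vec2 : Set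
  Vec2 = F × F

  act : ΓL2 → Vec2 → Vec2
  act φ (x , y) = (a * σ x + b * σ y , c * σ x + d * σ y)
    where open ΓL2 φ
          open FieldAut aut

  NonZero2 : Vec2 → Set
  NonZero2 (x , y) = ¬ (x ≡ 0# × y ≡ 0#)

  SamePoint : Vec2 → Vec2 → Set
  SamePoint (x , y) v = ∃[ l ] (¬ (l ≡ 0#) × v ≡ (l * x , l * y))

  -- a point set of PG(1,q^n), as the predicate "the nonzero vector v spans a point of the set"
  PointSet : Set₁
  PointSet = Vec2 → Set

  L : QPoly → PointSet
  L f v = NonZero2 v × ∃[ x ] (¬ (x ≡ 0#) × SamePoint (x , eval f x) v)

  image : ΓL2 → PointSet → PointSet
  image φ S v = ∃[ w ] (S w × SamePoint (act φ w) v)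

  _≐_ : PointSet → PointSet → Set
  S ≐ T = ∀ v → (S v → T v) × (T v → S v)

  PΓLEquivalent : PointSet → PointSet → Set
  PΓLEquivalent S T = ∃[ φ ] (image φ S ≐ T)

  kf : ΓL2 → QPoly → F → F
  kf φ f x = a * σ x + b * σ (eval f x)
    where open ΓL2 φ
          open FieldAut aut

  hf : ΓL2 → QPoly → F → F
  hf φ f x = c * σ x + d * σ (eval f x)
    where open ΓL2 φ
          open FieldAut aut

  Defined : ΓL2 → QPoly → Set
  Defined φ f = Bijection (kf φ f)

  fφ : (φ : ΓL2) (f : QPoly) → Defined φ f → F → F
  fφ φ f d x = hf φ f (Bijection.inv d x)

  Im : (F → F) → F → Set
  Im h y = ∃[ x ] (¬ (x ≡ 0#) × y ≡ h x * (x ⁻¹))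

  _≐F_ : (F → Set) → (F → Set) → Set
  S ≐F T = ∀ y → (S y → T y) × (T y → S y)

-- Over a field of characteristic p the map x ↦ x ^ p is additive (p divides the inner
-- binomial coefficients), so every q-polynomial, and with it k_f(x) = a x^σ + b f(x)^σ,
-- is additive; the characteristic is read off from |F| · 1 = 0, which follows by comparing
-- the sum of all field elements with the sum of their translates by 1.
-- The image of L_f under φ is the set of points ⟨(k_f x, h_f x)⟩, x ≠ 0, whereas every
-- point ⟨(x, g x)⟩ of L_g has nonzero first coordinate.  Hence φ(L_f) = L_g forces k_f to
-- have trivial kernel, so it is injective and, F being finite, bijective.  Substituting
-- x = k_f⁻¹(y) rewrites φ(L_f) as {⟨(y, f_φ y)⟩ : y ≠ 0}, and two point sets of this graph
-- shape coincide exactly when their slope sets Im(G(x)/x) do, as ⟨(x, G x)⟩ = ⟨(1, G x / x)⟩.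

module Submission where

open import Defs
open import Level using (0ℓ)
open import Algebra.Bundles using (CommutativeSemiring; CommutativeRing)
open import Data.Nat as ℕ using (ℕ; zero; suc; _∸_; _<_; _!; s≤s; z≤n; nonTrivial⇒≢1)
import Data.Nat.Properties as ℕP
open ℕP using (_!*_!≢0; <⇒≤; <⇒≱; <-trans; n<1+n; ∸-monoʳ-<; n∸n≡0)
open import Data.Nat.Divisibility using (_∣_; _∤_; divides; ∣⇒≤; ∣1⇒≡1; m∣m*n)
open import Data.Nat.DivMod using (m/n*n≡m)
open import Data.Nat.Primality using (Prime; prime; euclidsLemma)
open import Data.Nat.Combinatorics using (_C_; nCn≡1; k![n∸k]!∣n!; nCk≡n!/k![n-k]!)
open import Data.Fin as Fin using (Fin; zero; suc; toℕ; fromℕ; inject₁)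
open import Data.Fin.Properties using (toℕ-fromℕ; toℕ<n; toℕ-inject₁; any?; injective⇒≤; punchOut-injective)
open import Function.Definitions using (Injective)
open import Relation.Unary using (_⊆_)
open import Data.Product using (Σ; ∃-syntax; _×_; _,_; proj₁; proj₂)
open import Data.Sum using (_⊎_; inj₁; inj₂; [_,_])
open import Function using (id; _∘_)
open import Function.Bundles using (_⇔_; mk⇔; Equivalence; _↣_; mk↣; _↔_; mk↔ₛ′; Injection; Inverse)
open import Function.Construct.Composition using (_↣-∘_; _↔-∘_)
open import Function.Construct.Symmetry using (↔-sym)
open import Relation.Nullary using (yes; no; contradiction)
open import Data.Empty using (⊥-elim)
open import Relation.Nullary.Decidable using (via-injection)
open import Relation.Binary.Definitions using (DecidableEquality)
open import Function.Properties.Inverse using (↔⇒↣)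
import Relation.Binary.PropositionalEquality as ≡
open ≡ using (_≡_; _≢_; refl)

prime∤! : ∀ {p m} → Prime p → m < p → p ∤ m !
prime∤! {m = zero}  (prime _) _   p∣1 = nonTrivial⇒≢1 (∣1⇒≡1 p∣1)
prime∤! {m = suc m} p-prime m<p p∣m! with euclidsLemma (suc m) (m !) p-prime p∣m!
... | inj₁ p∣1+m = <⇒≱ m<p (∣⇒≤ p∣1+m)
... | inj₂ p∣m!  = prime∤! p-prime (<-trans (n<1+n m) m<p) p∣m!

prime∣pCk : ∀ {p k} → Prime p → 0 < k → k < p → p ∣ p C k
prime∣pCk {p@(suc p-1)} {k} p-prime 0<k k<p =
  [ id , ⊥-elim ∘ p∤k!*[p∸k]! ] (euclidsLemma (p C k) (k ! ℕ.* (p ∸ k) !) p-prime p∣pCk*k!*[p∸k]!)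
  where
  instance _ = k !* (p ∸ k) !≢0
  p∸k<p : p ∸ k < p
  p∸k<p = ∸-monoʳ-< {p} {k} {0} 0<k (<⇒≤ k<p)
  p∤k!*[p∸k]! : p ∤ k ! ℕ.* (p ∸ k) !
  p∤k!*[p∸k]! = [ prime∤! p-prime k<p , prime∤! p-prime p∸k<p ] ∘ euclidsLemma (k !) ((p ∸ k) !) p-prime
  pCk*k!*[p∸k]!≡p! : (p C k) ℕ.* (k ! ℕ.* (p ∸ k) !) ≡ p !
  pCk*k!*[p∸k]!≡p! = ≡.trans (≡.cong (ℕ._* (k ! ℕ.* (p ∸ k) !)) (nCk≡n!/k![n-k]! (<⇒≤ k<p)))
                             (m/n*n≡m (k![n∸k]!∣n! (<⇒≤ k<p)))
  p∣pCk*k!*[p∸k]! : p ∣ (p C k) ℕ.* (k ! ℕ.* (p ∸ k) !)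
  p∣pCk*k!*[p∸k]! = ≡.subst (p ∣_) (≡.sym pCk*k!*[p∸k]!≡p!) (m∣m*n (p-1 !))

Fin-injective⇒surjective : ∀ {m} {g : Fin m → Fin m} → Injective _≡_ _≡_ g → ∀ y → ∃[ x ] g x ≡ y
Fin-injective⇒surjective {suc m} {g} g-injective y with any? (λ x → g x Fin.≟ y)
... | yes hit  = hit
... | no  miss = contradiction (injective⇒≤ punchOut∘g-injective) ℕP.1+n≰n
  where
  y≢g : ∀ x → y ≢ g x
  y≢g x y≡gx = miss (x , ≡.sym y≡gx)
  punchOut∘g-injective : Injective _≡_ _≡_ (λ x → Fin.punchOut (y≢g x))
  punchOut∘g-injective = g-injective ∘ punchOut-injective (y≢g _) (y≢g _)

module FrobeniusProperties {c ℓ} (R : CommutativeSemiring c ℓ) where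
  open CommutativeSemiring R hiding (zero)
  open import Algebra.Properties.Semiring.Mult semiring renaming (_×_ to _·_) using (×-homo-1; ×-assoc-*; ×-assocˡ; ×-congʳ)
  open import Algebra.Properties.Semiring.Exp semiring using (_^_; ^-assocʳ; ^-congˡ)
  open import Algebra.Properties.CommutativeSemiring.Binomial R using (theorem; binomialTerm)
  open import Algebra.Properties.CommutativeMonoid.Sum +-commutativeMonoid
    using (sum; sum-init-last; sum-cong-≋; sum-replicate-zero)
  open import Data.Vec.Functional using (tail)
  open import Relation.Binary.Reasoning.Setoid setoid

  inner≈0⇒sum≈first+last : ∀ m (t : Fin (suc (suc m)) → Carrier) → (∀ i → t (suc (inject₁ i)) ≈ 0#) →
                           sum t ≈ t zero + t (fromℕ (suc m))
  inner≈0⇒sum≈first+last m t inner≈0 = +-congˡ (begin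
    sum (tail t)                                         ≈⟨ sum-init-last (tail t) ⟩
    sum (λ i → t (suc (inject₁ i))) + t (fromℕ (suc m))  ≈⟨ +-congʳ (trans (sum-cong-≋ inner≈0) (sum-replicate-zero m)) ⟩
    0# + t (fromℕ (suc m))                               ≈⟨ +-identityˡ _ ⟩
    t (fromℕ (suc m))                                    ∎)

  p·1≈0⇒p·≈0 : ∀ {p} → p · 1# ≈ 0# → ∀ x → p · x ≈ 0#
  p·1≈0⇒p·≈0 {p} p·1≈0 x = begin
    p · x        ≈⟨ ×-congʳ p (*-identityˡ x) ⟨
    p · (1# * x) ≈⟨ ×-assoc-* p 1# x ⟨
    (p · 1#) * x ≈⟨ *-congʳ p·1≈0 ⟩
    0# * x       ≈⟨ zeroˡ x ⟩
    0#           ∎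

  ^p-homo-+ : ∀ {p} → Prime p → p · 1# ≈ 0# → ∀ x y → (x + y) ^ p ≈ x ^ p + y ^ p
  ^p-homo-+ {0} (prime ⦃ () ⦄ _)
  ^p-homo-+ {1} (prime ⦃ () ⦄ _)
  ^p-homo-+ {p@(suc (suc m))} p-prime p·1≈0 x y = begin
    (x + y) ^ p                                             ≈⟨ theorem p x y ⟩
    sum (binomialTerm x y p)                                ≈⟨ inner≈0⇒sum≈first+last (suc m) (binomialTerm x y p) inner≈0 ⟩
    binomialTerm x y p zero + binomialTerm x y p (fromℕ p)  ≈⟨ +-comm _ _ ⟩
    binomialTerm x y p (fromℕ p) + binomialTerm x y p zero  ≈⟨ +-cong last≈x^p first≈y^p ⟩
    x ^ p + y ^ p                                           ∎
    where
    first≈y^p : binomialTerm x y p zero ≈ y ^ p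
    first≈y^p = trans (×-homo-1 _) (*-identityˡ _)
    last≈x^p : binomialTerm x y p (fromℕ p) ≈ x ^ p
    last≈x^p = begin
      (p C toℕ (fromℕ p)) · (x ^ toℕ (fromℕ p) * y ^ (p ∸ toℕ (fromℕ p)))
        ≡⟨ ≡.cong (λ j → (p C j) · (x ^ j * y ^ (p ∸ j))) (toℕ-fromℕ p) ⟩
      (p C p) · (x ^ p * y ^ (p ∸ p))
        ≡⟨ ≡.cong₂ (λ coeff j → coeff · (x ^ p * y ^ j)) (nCn≡1 p) (n∸n≡0 p) ⟩
      1 · (x ^ p * 1#) ≈⟨ ×-homo-1 _ ⟩
      x ^ p * 1#       ≈⟨ *-identityʳ _ ⟩
      x ^ p            ∎
    inner≈0 : ∀ i → binomialTerm x y p (suc (inject₁ i)) ≈ 0#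
    inner≈0 i with prime∣pCk p-prime (s≤s z≤n) (s≤s (≡.subst (_< suc m) (≡.sym (toℕ-inject₁ i)) (toℕ<n i)))
    ... | divides c pCk≡c*p = begin
      (p C k) · b   ≡⟨ ≡.cong (_· b) (≡.trans pCk≡c*p (ℕP.*-comm c p)) ⟩
      (p ℕ.* c) · b ≈⟨ ×-assocˡ b p c ⟨
      p · (c · b)   ≈⟨ p·1≈0⇒p·≈0 {p} p·1≈0 (c · b) ⟩
      0#            ∎
      where
      k : ℕ
      k = suc (toℕ (inject₁ i))
      b : Carrier
      b = x ^ k * y ^ (p ∸ k)

  ^[p^j]-homo-+ : ∀ {p} → Prime p → p · 1# ≈ 0# →
                  ∀ j x y → (x + y) ^ (p ℕ.^ j) ≈ x ^ (p ℕ.^ j) + y ^ (p ℕ.^ j)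
  ^[p^j]-homo-+ _ _ zero x y = trans (*-identityʳ _) (+-cong (sym (*-identityʳ x)) (sym (*-identityʳ y)))
  ^[p^j]-homo-+ {p} p-prime p·1≈0 (suc j) x y = begin
    (x + y) ^ (p ℕ.* p ℕ.^ j)                  ≈⟨ ^-assocʳ (x + y) p (p ℕ.^ j) ⟨
    ((x + y) ^ p) ^ (p ℕ.^ j)                  ≈⟨ ^-congˡ (p ℕ.^ j) (^p-homo-+ p-prime p·1≈0 x y) ⟩
    (x ^ p + y ^ p) ^ (p ℕ.^ j)                ≈⟨ ^[p^j]-homo-+ p-prime p·1≈0 j (x ^ p) (y ^ p) ⟩
    (x ^ p) ^ (p ℕ.^ j) + (y ^ p) ^ (p ℕ.^ j)  ≈⟨ +-cong (^-assocʳ x p (p ℕ.^ j)) (^-assocʳ y p (p ℕ.^ j)) ⟩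
    x ^ (p ℕ.* p ℕ.^ j) + y ^ (p ℕ.* p ℕ.^ j)  ∎

module FieldProperties {q n : ℕ} (K : FiniteField q n) where
  open FiniteField K public

  commutativeRing : CommutativeRing 0ℓ 0ℓ
  commutativeRing = record { isCommutativeRing = isCommutativeRing }

  open CommutativeRing commutativeRing public
    using ( +-identityʳ; -‿inverseʳ; distribˡ; zeroʳ; *-comm; *-assoc; *-identityˡ; *-identityʳ
          ; ring; semiring; commutativeSemiring; +-commutativeMonoid
          ; *-commutativeSemigroup; +-commutativeSemigroup)
  open import Algebra.Properties.CommutativeSemigroup *-commutativeSemigroup public
    using (x∙yz≈y∙xz) renaming (interchange to *-interchange)
  open import Algebra.Properties.CommutativeSemigroup +-commutativeSemigroup public
    using () renaming (interchange to +-interchange)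
  open import Algebra.Properties.Ring ring public
    using ( x+x≈x⇒x≈0; +-inverseʳ-unique; +-identityʳ-unique; x∙y⁻¹≈ε⇒x≈y; x≈y⇒x∙y⁻¹≈ε
          ; //-rightDividesˡ; //-rightDividesʳ)
  open import Algebra.Properties.Semiring.Mult semiring using (×1-homo-*; ×-homo-1) renaming (_×_ to _·_)
  open import Algebra.Properties.Semiring.Exp semiring using (_^_)
  open import Algebra.Properties.CommutativeMonoid.Sum +-commutativeMonoid
    using (sum; sum-permute; sum-cong-≗; ∑-distrib-+; sum-replicate)
  open FrobeniusProperties commutativeSemiring using (^[p^j]-homo-+)
  open ≡ using (sym; trans; cong; cong₂) public
  open ≡.≡-Reasoning public

  _≟_ : DecidableEquality Carrier
  _≟_ = via-injection (↔⇒↣ card) Fin._≟_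

  ⁻¹-inverseˡ : ∀ {x} → x ≢ 0# → x ⁻¹ * x ≡ 1#
  ⁻¹-inverseˡ {x} x≢0 = trans (*-comm (x ⁻¹) x) (⁻¹-inverse x x≢0)

  x⁻¹*[x*y]≡y : ∀ {x} y → x ≢ 0# → x ⁻¹ * (x * y) ≡ y
  x⁻¹*[x*y]≡y {x} y x≢0 = begin
    x ⁻¹ * (x * y)   ≡⟨ *-assoc (x ⁻¹) x y ⟨
    x ⁻¹ * x * y     ≡⟨ cong (_* y) (⁻¹-inverseˡ x≢0) ⟩
    1# * y           ≡⟨ *-identityˡ y ⟩
    y                ∎

  ⁻¹-unique : ∀ {x y} → x ≢ 0# → x * y ≡ 1# → y ≡ x ⁻¹
  ⁻¹-unique {x} {y} x≢0 x*y≡1 = begin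
    y                ≡⟨ x⁻¹*[x*y]≡y y x≢0 ⟨
    x ⁻¹ * (x * y)   ≡⟨ cong (x ⁻¹ *_) x*y≡1 ⟩
    x ⁻¹ * 1#        ≡⟨ *-identityʳ (x ⁻¹) ⟩
    x ⁻¹             ∎

  x*y≡0⇒y≡0 : ∀ {x y} → x ≢ 0# → x * y ≡ 0# → y ≡ 0#
  x*y≡0⇒y≡0 {x} {y} x≢0 x*y≡0 = begin
    y                ≡⟨ x⁻¹*[x*y]≡y y x≢0 ⟨
    x ⁻¹ * (x * y)   ≡⟨ cong (x ⁻¹ *_) x*y≡0 ⟩
    x ⁻¹ * 0#        ≡⟨ zeroʳ (x ⁻¹) ⟩
    0#               ∎

  x*y≢0 : ∀ {x y} → x ≢ 0# → y ≢ 0# → x * y ≢ 0#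
  x*y≢0 x≢0 y≢0 = y≢0 ∘ x*y≡0⇒y≡0 x≢0

  x*y≡0⇒x≡0∨y≡0 : ∀ x y → x * y ≡ 0# → x ≡ 0# ⊎ y ≡ 0#
  x*y≡0⇒x≡0∨y≡0 x y x*y≡0 with x ≟ 0#
  ... | yes x≡0 = inj₁ x≡0
  ... | no  x≢0 = inj₂ (x*y≡0⇒y≡0 x≢0 x*y≡0)

  ⁻¹≢0 : ∀ {x} → x ≢ 0# → x ⁻¹ ≢ 0#
  ⁻¹≢0 {x} x≢0 x⁻¹≡0 = 0≢1 (begin
    0#         ≡⟨ zeroʳ x ⟨
    x * 0#     ≡⟨ cong (x *_) x⁻¹≡0 ⟨
    x * x ⁻¹   ≡⟨ ⁻¹-inverse x x≢0 ⟩
    1#         ∎)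

  ⁻¹-distrib-* : ∀ {x y} → x ≢ 0# → y ≢ 0# → (x * y) ⁻¹ ≡ x ⁻¹ * y ⁻¹
  ⁻¹-distrib-* {x} {y} x≢0 y≢0 = sym (⁻¹-unique (x*y≢0 x≢0 y≢0) (begin
    x * y * (x ⁻¹ * y ⁻¹)       ≡⟨ *-interchange x y (x ⁻¹) (y ⁻¹) ⟩
    (x * x ⁻¹) * (y * y ⁻¹)     ≡⟨ cong₂ _*_ (⁻¹-inverse x x≢0) (⁻¹-inverse y y≢0) ⟩
    1# * 1#                     ≡⟨ *-identityʳ 1# ⟩
    1#                          ∎))

  x*y⁻¹*y≡x : ∀ x {y} → y ≢ 0# → x * y ⁻¹ * y ≡ x
  x*y⁻¹*y≡x x {y} y≢0 = begin
    x * y ⁻¹ * y     ≡⟨ *-assoc x (y ⁻¹) y ⟩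
    x * (y ⁻¹ * y)   ≡⟨ cong (x *_) (⁻¹-inverseˡ y≢0) ⟩
    x * 1#           ≡⟨ *-identityʳ x ⟩
    x                ∎

  [l*x]*[l*y]⁻¹≡x*y⁻¹ : ∀ {l} x {y} → l ≢ 0# → y ≢ 0# → (l * x) * (l * y) ⁻¹ ≡ x * y ⁻¹
  [l*x]*[l*y]⁻¹≡x*y⁻¹ {l} x {y} l≢0 y≢0 = begin
    (l * x) * (l * y) ⁻¹        ≡⟨ cong ((l * x) *_) (⁻¹-distrib-* l≢0 y≢0) ⟩
    (l * x) * (l ⁻¹ * y ⁻¹)     ≡⟨ *-interchange l x (l ⁻¹) (y ⁻¹) ⟩
    (l * l ⁻¹) * (x * y ⁻¹)     ≡⟨ cong (_* (x * y ⁻¹)) (⁻¹-inverse l l≢0) ⟩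
    1# * (x * y ⁻¹)             ≡⟨ *-identityˡ (x * y ⁻¹) ⟩
    x * y ⁻¹                    ∎

  injective⇒≢0 : ∀ {h} → Injective _≡_ _≡_ h → h 0# ≡ 0# → ∀ {x} → x ≢ 0# → h x ≢ 0#
  injective⇒≢0 h-injective h0≡0 x≢0 hx≡0 = x≢0 (h-injective (trans hx≡0 (sym h0≡0)))

  Bijection⇒injective : ∀ {k} → Bijection K k → Injective _≡_ _≡_ k
  Bijection⇒injective {k} k-bij {x} {y} kx≡ky = begin
    x          ≡⟨ inv-l x ⟨
    inv (k x)  ≡⟨ cong inv kx≡ky ⟩
    inv (k y)  ≡⟨ inv-l y ⟩
    y          ∎
    where open Bijection k-bij

  module _ {h : Carrier → Carrier} (h-homo-+ : ∀ x y → h (x + y) ≡ h x + h y) where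

    homo-+⇒homo-0 : h 0# ≡ 0#
    homo-+⇒homo-0 = x+x≈x⇒x≈0 (h 0#) (begin
      h 0# + h 0#   ≡⟨ h-homo-+ 0# 0# ⟨
      h (0# + 0#)   ≡⟨ cong h (+-identityʳ 0#) ⟩
      h 0#          ∎)

    homo-+⇒homo-neg : ∀ x → h (- x) ≡ - h x
    homo-+⇒homo-neg x = +-inverseʳ-unique (h x) (h (- x)) (begin
      h x + h (- x) ≡⟨ h-homo-+ x (- x) ⟨
      h (x + - x)   ≡⟨ cong h (-‿inverseʳ x) ⟩
      h 0#          ≡⟨ homo-+⇒homo-0 ⟩
      0#            ∎)

    homo-+⇒injective : (∀ x → x ≢ 0# → h x ≢ 0#) → Injective _≡_ _≡_ h
    homo-+⇒injective h≢0 {x} {y} hx≡hy with (x + - y) ≟ 0#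
    ... | yes x-y≡0 = x∙y⁻¹≈ε⇒x≈y x y x-y≡0
    ... | no  x-y≢0 = contradiction (begin
      h (x + - y)   ≡⟨ h-homo-+ x (- y) ⟩
      h x + h (- y) ≡⟨ cong (h x +_) (homo-+⇒homo-neg y) ⟩
      h x + - h y   ≡⟨ x≈y⇒x∙y⁻¹≈ε hx≡hy ⟩
      0#            ∎) (h≢0 (x + - y) x-y≢0)

  injective⇒Bijection : ∀ {k} → Injective _≡_ _≡_ k → Bijection K k
  injective⇒Bijection {k} k-injective = record
    { inv   = inv
    ; inv-l = λ x → k-injective (inv-r (k x))
    ; inv-r = inv-r
    }
    where
    open Inverse card using (to; from)
    k̂ : Fin (q ℕ.^ n) ↣ Fin (q ℕ.^ n)
    k̂ = ↔⇒↣ card ↣-∘ (mk↣ k-injective ↣-∘ ↔⇒↣ (↔-sym card))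
    k̂-onto : ∀ i → ∃[ j ] to (k (from j)) ≡ i
    k̂-onto = Fin-injective⇒surjective (Injection.injective k̂)
    inv : Carrier → Carrier
    inv y = from (proj₁ (k̂-onto (to y)))
    inv-r : ∀ y → k (inv y) ≡ y
    inv-r y = Injection.injective (↔⇒↣ card) (proj₂ (k̂-onto (to y)))

  card·1≡0 : (q ℕ.^ n) · 1# ≡ 0#
  card·1≡0 = +-identityʳ-unique S (N · 1#) (sym S≡S+N·1)
    where
    open Inverse card using (to; from; strictlyInverseʳ)
    N : ℕ
    N = q ℕ.^ n
    S : Carrier
    S = sum from
    translation : Carrier ↔ Carrier
    translation = mk↔ₛ′ (_+ 1#) (_+ - 1#) (//-rightDividesˡ 1#) (//-rightDividesʳ 1#)
    S≡S+N·1 : S ≡ S + N · 1#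
    S≡S+N·1 = begin
      S                                        ≡⟨ sum-permute from (card ↔-∘ (translation ↔-∘ ↔-sym card)) ⟩
      sum {N} (λ i → from (to (from i + 1#)))  ≡⟨ sum-cong-≗ (λ i → strictlyInverseʳ (from i + 1#)) ⟩
      sum {N} (λ i → from i + 1#)              ≡⟨ ∑-distrib-+ from (λ _ → 1#) ⟩
      S + sum {N} (λ _ → 1#)                   ≡⟨ cong (S +_) (sum-replicate N) ⟩
      S + N · 1#                               ∎

  p^m·1≡0⇒p·1≡0 : ∀ p m → (p ℕ.^ m) · 1# ≡ 0# → p · 1# ≡ 0#
  p^m·1≡0⇒p·1≡0 p zero    1·1≡0 = contradiction (trans (sym (×-homo-1 1#)) 1·1≡0) (0≢1 ∘ sym)
  p^m·1≡0⇒p·1≡0 p (suc m) p^[1+m]·1≡0 =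
    [ id , p^m·1≡0⇒p·1≡0 p m ]
    (x*y≡0⇒x≡0∨y≡0 (p · 1#) ((p ℕ.^ m) · 1#) (trans (sym (×1-homo-* p (p ℕ.^ m))) p^[1+m]·1≡0))

  pow≗^ : ∀ x m → pow K x m ≡ x ^ m
  pow≗^ x zero    = refl
  pow≗^ x (suc m) = cong (x *_) (pow≗^ x m)

  pow[q^i]-homo-+ : IsPrimePower q → ∀ i x y → pow K (x + y) (q ℕ.^ i) ≡ pow K x (q ℕ.^ i) + pow K y (q ℕ.^ i)
  pow[q^i]-homo-+ (p , k , p-prime , _ , q≡p^k) i x y = begin
    pow K (x + y) (q ℕ.^ i)                        ≡⟨ pow[q^i]≡^[p^[k*i]] (x + y) ⟩
    (x + y) ^ (p ℕ.^ (k ℕ.* i))                    ≡⟨ ^[p^j]-homo-+ p-prime p·1≡0 (k ℕ.* i) x y ⟩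
    x ^ (p ℕ.^ (k ℕ.* i)) + y ^ (p ℕ.^ (k ℕ.* i))  ≡⟨ cong₂ _+_ (pow[q^i]≡^[p^[k*i]] x) (pow[q^i]≡^[p^[k*i]] y) ⟨
    pow K x (q ℕ.^ i) + pow K y (q ℕ.^ i)          ∎
    where
    q^j≡p^[k*j] : ∀ j → q ℕ.^ j ≡ p ℕ.^ (k ℕ.* j)
    q^j≡p^[k*j] j = trans (cong (ℕ._^ j) q≡p^k) (ℕP.^-*-assoc p k j)
    p·1≡0 : p · 1# ≡ 0#
    p·1≡0 = p^m·1≡0⇒p·1≡0 p (k ℕ.* n) (≡.subst (λ e → e · 1# ≡ 0#) (q^j≡p^[k*j] n) card·1≡0)
    pow[q^i]≡^[p^[k*i]] : ∀ z → pow K z (q ℕ.^ i) ≡ z ^ (p ℕ.^ (k ℕ.* i))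
    pow[q^i]≡^[p^[k*i]] z = trans (pow≗^ z (q ℕ.^ i)) (cong (z ^_) (q^j≡p^[k*j] i))

  ΣF≡sum : ∀ m (t : Fin m → Carrier) → ΣF K m t ≡ sum t
  ΣF≡sum zero    t = refl
  ΣF≡sum (suc m) t = cong (t zero +_) (ΣF≡sum m (t ∘ suc))

  eval-homo-+ : IsPrimePower q → ∀ f x y → eval K f (x + y) ≡ eval K f x + eval K f y
  eval-homo-+ q-prime-power f x y = begin
    eval K f (x + y)                  ≡⟨ ΣF≡sum n (term (x + y)) ⟩
    sum (term (x + y))                ≡⟨ sum-cong-≗ term-homo-+ ⟩
    sum (λ i → term x i + term y i)   ≡⟨ ∑-distrib-+ (term x) (term y) ⟩
    sum (term x) + sum (term y)       ≡⟨ cong₂ _+_ (ΣF≡sum n (term x)) (ΣF≡sum n (term y)) ⟨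
    eval K f x + eval K f y           ∎
    where
    term : Carrier → Fin n → Carrier
    term z i = f i * pow K z (q ℕ.^ toℕ i)
    term-homo-+ : ∀ i → term (x + y) i ≡ term x i + term y i
    term-homo-+ i = trans (cong (f i *_) (pow[q^i]-homo-+ q-prime-power (toℕ i) x y)) (distribˡ (f i) _ _)

module ProjectiveLine {q n : ℕ} (K : FiniteField q n) where
  open FieldProperties K

  infixr 7 _•_
  _•_ : Carrier → Vec2 K → Vec2 K
  l • (x , y) = (l * x , l * y)

  •-assoc : ∀ l m w → l • (m • w) ≡ (l * m) • w
  •-assoc l m (x , y) = cong₂ _,_ (sym (*-assoc l m x)) (sym (*-assoc l m y))

  graph : (Carrier → Carrier) → Carrier → Vec2 K
  graph G x = (x , G x)

  Spanned : (Carrier → Vec2 K) → PointSet K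
  Spanned u v = ∃[ x ] (x ≢ 0# × SamePoint K (u x) v)

  u∈Spanned : ∀ {u x} → x ≢ 0# → Spanned u (u x)
  u∈Spanned {u} {x} x≢0 = x , x≢0 , 1# , 0≢1 ∘ sym , sym (cong₂ _,_ (*-identityˡ _) (*-identityˡ _))

  ≐-sym : ∀ {S T} → _≐_ K S T → _≐_ K T S
  ≐-sym S≐T v = proj₂ (S≐T v) , proj₁ (S≐T v)

  ≐-trans : ∀ {S T U} → _≐_ K S T → _≐_ K T U → _≐_ K S U
  ≐-trans S≐T T≐U v = proj₁ (T≐U v) ∘ proj₁ (S≐T v) , proj₂ (S≐T v) ∘ proj₂ (T≐U v)

  Spanned-graph⇒proj₁≢0 : ∀ {G v} → Spanned (graph G) v → proj₁ v ≢ 0#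
  Spanned-graph⇒proj₁≢0 (x , x≢0 , l , l≢0 , refl) = x*y≢0 l≢0 x≢0

  L≐Spanned-graph : ∀ f → _≐_ K (L K f) (Spanned (graph (eval K f)))
  L≐Spanned-graph f v = proj₂ , λ spanned → (λ (v₁≡0 , _) → Spanned-graph⇒proj₁≢0 spanned v₁≡0) , spanned

  Spanned-reparametrise : ∀ {k h} (k-bij : Bijection K k) → k 0# ≡ 0# →
                          _≐_ K (Spanned (λ x → (k x , h x))) (Spanned (graph (h ∘ Bijection.inv k-bij)))
  Spanned-reparametrise {k} {h} k-bij k0≡0 v = to , from
    where
    open Bijection k-bij
    inv≢0 : ∀ {y} → y ≢ 0# → inv y ≢ 0#
    inv≢0 {y} y≢0 inv-y≡0 = y≢0 (begin
      y          ≡⟨ inv-r y ⟨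
      k (inv y)  ≡⟨ cong k inv-y≡0 ⟩
      k 0#       ≡⟨ k0≡0 ⟩
      0#         ∎)
    to : Spanned (λ x → (k x , h x)) v → Spanned (graph (h ∘ inv)) v
    to (x , x≢0 , l , l≢0 , refl) =
      k x , injective⇒≢0 (Bijection⇒injective k-bij) k0≡0 x≢0 ,
      l , l≢0 , cong (λ z → l • (k x , h z)) (sym (inv-l x))
    from : Spanned (graph (h ∘ inv)) v → Spanned (λ x → (k x , h x)) v
    from (y , y≢0 , l , l≢0 , refl) =
      inv y , inv≢0 y≢0 , l , l≢0 , cong (λ z → l • (z , h (inv y))) (sym (inv-r y))

  Spanned-graph-mono : ∀ {G G'} → Im K G ⊆ Im K G' → Spanned (graph G) ⊆ Spanned (graph G')
  Spanned-graph-mono {G} {G'} ImG⊆ImG' (x , x≢0 , l , l≢0 , refl)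
    with ImG⊆ImG' (x , x≢0 , refl)
  ... | x' , x'≢0 , Gx*x⁻¹≡G'x'*x'⁻¹ =
    x' , x'≢0 , c , x*y≢0 (x*y≢0 l≢0 x≢0) (⁻¹≢0 x'≢0) , cong₂ _,_ (sym c*x'≡l*x) (sym c*G'x'≡l*Gx)
    where
    c : Carrier
    c = l * x * x' ⁻¹
    c*x'≡l*x : c * x' ≡ l * x
    c*x'≡l*x = x*y⁻¹*y≡x (l * x) x'≢0
    c*G'x'≡l*Gx : c * G' x' ≡ l * G x
    c*G'x'≡l*Gx = begin
      l * x * x' ⁻¹ * G' x'      ≡⟨ *-assoc (l * x) (x' ⁻¹) (G' x') ⟩
      l * x * (x' ⁻¹ * G' x')    ≡⟨ cong (l * x *_) (*-comm (x' ⁻¹) (G' x')) ⟩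
      l * x * (G' x' * x' ⁻¹)    ≡⟨ cong (l * x *_) Gx*x⁻¹≡G'x'*x'⁻¹ ⟨
      l * x * (G x * x ⁻¹)       ≡⟨ *-assoc l x (G x * x ⁻¹) ⟩
      l * (x * (G x * x ⁻¹))     ≡⟨ cong (l *_) (x∙yz≈y∙xz x (G x) (x ⁻¹)) ⟩
      l * (G x * (x * x ⁻¹))     ≡⟨ cong (λ z → l * (G x * z)) (⁻¹-inverse x x≢0) ⟩
      l * (G x * 1#)             ≡⟨ cong (l *_) (*-identityʳ (G x)) ⟩
      l * G x                    ∎

  Spanned-graph-mono⁻¹ : ∀ {G G'} → Spanned (graph G) ⊆ Spanned (graph G') → Im K G ⊆ Im K G'
  Spanned-graph-mono⁻¹ {G} {G'} Spanned⊆ (x , x≢0 , refl)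
    with Spanned⊆ (u∈Spanned {graph G} x≢0)
  ... | x' , x'≢0 , l , l≢0 , x,Gx≡l•x',G'x' = x' , x'≢0 , (begin
    G x * x ⁻¹                     ≡⟨ cong₂ (λ a b → a * b ⁻¹) (cong proj₂ x,Gx≡l•x',G'x') (cong proj₁ x,Gx≡l•x',G'x') ⟩
    (l * G' x') * (l * x') ⁻¹      ≡⟨ [l*x]*[l*y]⁻¹≡x*y⁻¹ (G' x') l≢0 x'≢0 ⟩
    G' x' * x' ⁻¹                  ∎)

  Spanned-graph≐⇔Im≐ : ∀ {G G'} → _≐_ K (Spanned (graph G)) (Spanned (graph G')) ⇔ _≐F_ K (Im K G) (Im K G')
  Spanned-graph≐⇔Im≐ = mk⇔
    (λ Spanned≐ _ → Spanned-graph-mono⁻¹ (proj₁ (Spanned≐ _)) , Spanned-graph-mono⁻¹ (proj₂ (Spanned≐ _)))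
    (λ Im≐ _ → Spanned-graph-mono (proj₁ (Im≐ _)) , Spanned-graph-mono (proj₂ (Im≐ _)))

module SemilinearImage {q n : ℕ} (K : FiniteField q n) (q-prime-power : IsPrimePower q)
                       (φ : ΓL2 K) (f : QPoly K) where
  open FieldProperties K
  open ProjectiveLine K
  open ΓL2 φ
  open FieldAut aut

  k h : Carrier → Carrier
  k = kf K φ f
  h = hf K φ f

  σ≢0 : ∀ {x} → x ≢ 0# → σ x ≢ 0#
  σ≢0 = injective⇒≢0 (Bijection⇒injective σ-bij) (homo-+⇒homo-0 σ-+)

  act-• : ∀ m w → act K φ (m • w) ≡ σ m • act K φ w
  act-• m (x , y) = cong₂ _,_ (semilinear a b) (semilinear c d)
    where
    semilinear : ∀ a b → a * σ (m * x) + b * σ (m * y) ≡ σ m * (a * σ x + b * σ y)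
    semilinear a b = begin
      a * σ (m * x) + b * σ (m * y)           ≡⟨ cong₂ (λ u v → a * u + b * v) (σ-* m x) (σ-* m y) ⟩
      a * (σ m * σ x) + b * (σ m * σ y)       ≡⟨ cong₂ _+_ (x∙yz≈y∙xz a (σ m) (σ x)) (x∙yz≈y∙xz b (σ m) (σ y)) ⟩
      σ m * (a * σ x) + σ m * (b * σ y)       ≡⟨ distribˡ (σ m) (a * σ x) (b * σ y) ⟨
      σ m * (a * σ x + b * σ y)               ∎

  k-homo-+ : ∀ x y → k (x + y) ≡ k x + k y
  k-homo-+ x y = begin
    a * σ (x + y) + b * σ (eval K f (x + y))
      ≡⟨ cong₂ (λ u v → a * u + b * v) (σ-+ x y) (trans (cong σ (eval-homo-+ q-prime-power f x y)) (σ-+ _ _)) ⟩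
    a * (σ x + σ y) + b * (σ (eval K f x) + σ (eval K f y))
      ≡⟨ cong₂ _+_ (distribˡ a (σ x) (σ y)) (distribˡ b _ _) ⟩
    (a * σ x + a * σ y) + (b * σ (eval K f x) + b * σ (eval K f y))
      ≡⟨ +-interchange (a * σ x) (a * σ y) _ _ ⟩
    k x + k y
      ∎

  image≐Spanned : _≐_ K (image K φ (L K f)) (Spanned (λ x → (k x , h x)))
  image≐Spanned v = to , from
    where
    to : image K φ (L K f) v → Spanned (λ x → (k x , h x)) v
    to (_ , (_ , x , x≢0 , m , m≢0 , refl) , l , l≢0 , refl) =
      x , x≢0 , l * σ m , x*y≢0 l≢0 (σ≢0 m≢0) ,
      trans (cong (l •_) (act-• m (x , eval K f x))) (•-assoc l (σ m) (k x , h x))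
    from : Spanned (λ x → (k x , h x)) v → image K φ (L K f) v
    from (x , x≢0 , v∼[kx,hx]) = (x , eval K f x) , proj₂ (L≐Spanned-graph f _) (u∈Spanned x≢0) , v∼[kx,hx]

  Spanned-graph-fφ≐image : (d : Defined K φ f) → _≐_ K (Spanned (graph (fφ K φ f d))) (image K φ (L K f))
  Spanned-graph-fφ≐image d = ≐-sym (≐-trans image≐Spanned (Spanned-reparametrise d (homo-+⇒homo-0 k-homo-+)))

  image⊆Spanned-graph⇒Defined : ∀ {G} → image K φ (L K f) ⊆ Spanned (graph G) → Defined K φ f
  image⊆Spanned-graph⇒Defined image⊆ = injective⇒Bijection (homo-+⇒injective k-homo-+ k≢0)
    where
    k≢0 : ∀ x → x ≢ 0# → k x ≢ 0#
    k≢0 x x≢0 = Spanned-graph⇒proj₁≢0 (image⊆ (proj₂ (image≐Spanned _) (u∈Spanned x≢0)))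

proposition5p1 : (q n : ℕ) → IsPrimePower q → 1 < n → (K : FiniteField q n)
    → (f g : QPoly K)
    → PΓLEquivalent K (L K f) (L K g)
      ⇔ (∃[ φ ] Σ (Defined K φ f) (λ d → _≐F_ K (Im K (fφ K φ f d)) (Im K (eval K g))))
proposition5p1 q n q-prime-power _ K f g = mk⇔ to from
  where
  open ProjectiveLine K
  open SemilinearImage K q-prime-power

  to : PΓLEquivalent K (L K f) (L K g) →
       ∃[ φ ] Σ (Defined K φ f) (λ d → _≐F_ K (Im K (fφ K φ f d)) (Im K (eval K g)))
  to (φ , φLf≐Lg) = φ , d , Equivalence.to Spanned-graph≐⇔Im≐ (≐-trans (Spanned-graph-fφ≐image φ f d) φLf≐Lg′)
    where
    φLf≐Lg′ : _≐_ K (image K φ (L K f)) (Spanned (graph (eval K g)))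
    φLf≐Lg′ = ≐-trans φLf≐Lg (L≐Spanned-graph g)
    d : Defined K φ f
    d = image⊆Spanned-graph⇒Defined φ f (proj₁ (φLf≐Lg′ _))

  from : ∃[ φ ] Σ (Defined K φ f) (λ d → _≐F_ K (Im K (fφ K φ f d)) (Im K (eval K g))) →
         PΓLEquivalent K (L K f) (L K g)
  from (φ , d , Im≐) = φ , ≐-trans (≐-sym (Spanned-graph-fφ≐image φ f d))
                             (≐-trans (Equivalence.from Spanned-graph≐⇔Im≐ Im≐) (≐-sym (L≐Spanned-graph g)))
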